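{- Let $A$ and $B$ be posets with top and bottom, let $G$ be a game over $A$, and let $f:A\to B$ be monotone. If $G$ is realizable as a monotone set coloring game, then so is the game $f(G)$ over $B$.
   Context: Games over a poset $C$: atomic $[x]$ ($x\in C$) with no options, or composite $\{L\mid R\}$ with non-empty sets of left and right options. $\le$ and $\lhd$ by mutual recursion: $G\le H$ iff every left option $G^L$ satisfies $G^L\lhd H$, every right option $H^R$ satisfies $G\lhd H^R$, and if $G$ or $H$ is atomic then $G\lhd H$; $G\lhd H$ iff some $G^R\le H$, or $G\le$ some $H^L$, or $G=[x],H=[y]$ with $x\le y$; $G\equiv H$ iff $G\le H$ and $H\le G$. Map: $f([x])=[f(x)]$ and $f(\{G^L\mid G^R\})=\{f(G^L)\mid f(G^R)\}$. A monotone set coloring game $S$ over $C$ is a pair $(|S|,\phi_S)$ with $|S|$ a finite set of cells and $\phi_S:\{\bot,\top\}^{|S|}\to C$ monotone (pointwise order). Positions are maps $p:|S|\to\{\top,\bot,\star\}$, atomic if no $\star$. $[\![p]\!]=[\phi_S(p)]$ if $p$ is atomic, else $\{[\![p^L]\!]\mid[\![p^R]\!]\}$ where $p^L$ (resp. $p^R$) ranges over positions obtained by changing one $\star$-cell to $\top$ (resp. $\bot$); $[\![S]\!]$ is $[\![\cdot]\!]$ of the all-$\star$ position. $G$ is realizable if $G\equiv[\![S]\!]$ for some such $S$ over the same poset. -}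

module Defs where

open import Level using (Level; _⊔_)
open import Data.Nat using (ℕ; zero; suc)
open import Data.Fin using (Fin; _≟_)
open import Data.Bool as B using (Bool; true; false)
open import Data.List using (List; []; _∷_; filter)
open import Data.List.Base using (allFin)
open import Data.List.NonEmpty as L⁺ using (List⁺; _∷_)
open import Data.List.Relation.Unary.Any using (Any)
open import Data.List.Relation.Unary.All using (All)
open import Data.Product using (Σ; _×_; _,_)
open import Data.Sum using (_⊎_)
open import Data.Unit using (⊤)
open import Data.Empty using (⊥)
open import Relation.Nullary using (¬_; yes; no)
open import Relation.Binary.Bundles using (Poset)
open import Relation.Binary.Definitions using (Maximum; Minimum)

data Game {c} (C : Set c) : Set c where
  atom : C → Game C
  comp : List⁺ (Game C) → List⁺ (Game C) → Game C

module _ {c} {C : Set c} where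
  lefts : Game C → List (Game C)
  lefts (atom _) = []
  lefts (comp L R) = L⁺.toList L

  rights : Game C → List (Game C)
  rights (atom _) = []
  rights (comp L R) = L⁺.toList R

  IsAtomic : Game C → Set
  IsAtomic (atom _) = ⊤
  IsAtomic (comp _ _) = ⊥

module GameOrder {c ℓ₁ ℓ₂} (P : Poset c ℓ₁ ℓ₂) where
  open Poset P renaming (Carrier to C; _≤_ to _≤C_)

  data _≤G_ : Game C → Game C → Set (c ⊔ ℓ₂)
  data _⊲G_ : Game C → Game C → Set (c ⊔ ℓ₂)

  data _≤G_ where
    le : ∀ {G H}
       → All (λ GL → GL ⊲G H) (lefts G)
       → All (λ HR → G ⊲G HR) (rights H)
       → (IsAtomic G ⊎ IsAtomic H → G ⊲G H)
       → G ≤G H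

  data _⊲G_ where
    viaRight : ∀ {G H} → Any (λ GR → GR ≤G H) (rights G) → G ⊲G H
    viaLeft  : ∀ {G H} → Any (λ HL → G ≤G HL) (lefts H) → G ⊲G H
    viaAtom  : ∀ {x y} → x ≤C y → atom x ⊲G atom y

  _≡G_ : Game C → Game C → Set (c ⊔ ℓ₂)
  G ≡G H = (G ≤G H) × (H ≤G G)

module _ {a b} {A : Set a} {B : Set b} (f : A → B) where
  mapGame : Game A → Game B
  mapGame⁺ : List⁺ (Game A) → List⁺ (Game B)
  mapGameL : List (Game A) → List (Game B)

  mapGame (atom x) = atom (f x)
  mapGame (comp L R) = comp (mapGame⁺ L) (mapGame⁺ R)
  mapGame⁺ (G ∷ Gs) = mapGame G ∷ mapGameL Gs
  mapGameL [] = []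
  mapGameL (G ∷ Gs) = mapGame G ∷ mapGameL Gs

data Cell : Set where
  ⊤c ⊥c ⋆c : Cell

isStar : Cell → Bool
isStar ⋆c = true
isStar _  = false

module MSCG {c ℓ₁ ℓ₂} (P : Poset c ℓ₁ ℓ₂) where
  open Poset P renaming (Carrier to C; _≤_ to _≤C_)

  Coloring : ℕ → Set
  Coloring n = Fin n → Bool

  -- pointwise order on {⊥ ≤ ⊤}^cells, with false = ⊥, true = ⊤
  record MSCGame : Set (c ⊔ ℓ₂) where
    field
      size     : ℕ                      -- |S| is Fin size
      φ        : Coloring size → C
      monotone : ∀ (u v : Coloring size) → (∀ i → u i B.≤ v i) → φ u ≤C φ v

  Position : ℕ → Set
  Position n = Fin n → Cell

  set : ∀ {n} → Position n → Fin n → Cell → Position n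
  set p i s j with j ≟ i
  ... | yes _ = s
  ... | no  _ = p j

  -- only used on atomic positions (no ⋆); ⋆ never occurs there
  toColoring : ∀ {n} → Position n → Coloring n
  toColoring p i with p i
  ... | ⊤c = true
  ... | _  = false

  starCells : ∀ {n} → Position n → List (Fin n)
  starCells p = filter (λ i → isStar (p i) Data.Bool.≟ true) (allFin _)
    where import Data.Bool

  -- ⟦p⟧, defined with fuel k; the fuel is never exhausted when k ≥ number
  -- of ⋆-cells of p (each move removes one ⋆), so ⟦S⟧ = go size (all ⋆)
  -- is the game of the paper.
  module _ (S : MSCGame) where
    open MSCGame S

    go : ℕ → Position size → Game C
    goL : ℕ → Position size → Cell → List (Fin size) → List (Game C)
    go zero p = atom (φ (toColoring p))
    go (suc k) p with starCells p
    ... | [] = atom (φ (toColoring p))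
    ... | i ∷ is = comp (go k (set p i ⊤c) ∷ goL k p ⊤c is)
                        (go k (set p i ⊥c) ∷ goL k p ⊥c is)
    goL k p s [] = []
    goL k p s (i ∷ is) = go k (set p i s) ∷ goL k p s is

    ⟦_⟧pos : Position size → Game C
    ⟦ p ⟧pos = go size p

  ⟦_⟧ : MSCGame → Game C
  ⟦ S ⟧ = ⟦_⟧pos S (λ _ → ⋆c)

  open GameOrder P

  Realizable : Game C → Set (c ⊔ ℓ₂)
  Realizable G = Σ MSCGame (λ S → G ≡G ⟦ S ⟧)

HasTopBottom : ∀ {c ℓ₁ ℓ₂} → Poset c ℓ₁ ℓ₂ → Set (c ⊔ ℓ₂)
HasTopBottom P = Σ Carrier (Maximum _≤_) × Σ Carrier (Minimum _≤_)
  where open Poset P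

-- A monotone f commutes with both halves of the definition: it preserves ≤ and ⊲
-- of games by the same mutual induction that defines them, and post-composing
-- the colouring function of S with f yields a monotone colouring game whose
-- game tree is f applied to the tree of S. Hence G ≡ ⟦S⟧ gives f(G) ≡ ⟦f ∘ S⟧.
module Submission where

open import Defs
open import Relation.Binary.Bundles using (Poset)
open import Data.Nat using (zero; suc)
open import Data.List using ([]; _∷_)
open import Data.List.NonEmpty using (_∷_)
open import Data.List.Relation.Unary.Any using (Any; here; there)
open import Data.List.Relation.Unary.All using (All; []; _∷_)
open import Data.Product using (_,_)
open import Data.Sum using (inj₁; inj₂)
open import Relation.Binary.PropositionalEquality using (_≡_; refl; sym; cong₂; subst)

module MapMonotone {a ℓa₁ ℓa₂ b ℓb₁ ℓb₂} (A : Poset a ℓa₁ ℓa₂) (B : Poset b ℓb₁ ℓb₂)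
  (f : Poset.Carrier A → Poset.Carrier B)
  (f-mono : ∀ x y → Poset._≤_ A x y → Poset._≤_ B (f x) (f y)) where

  module GA = GameOrder A
  module GB = GameOrder B
  open GA using () renaming (_≤G_ to _≤A_; _⊲G_ to _⊲A_; _≡G_ to _≡A_)
  open GB using () renaming (_≤G_ to _≤B_; _⊲G_ to _⊲B_; _≡G_ to _≡B_)

  lefts-mapGame : ∀ G → lefts (mapGame f G) ≡ mapGameL f (lefts G)
  lefts-mapGame (atom _)         = refl
  lefts-mapGame (comp (_ ∷ _) _) = refl

  rights-mapGame : ∀ G → rights (mapGame f G) ≡ mapGameL f (rights G)
  rights-mapGame (atom _)         = refl
  rights-mapGame (comp _ (_ ∷ _)) = refl

  mapGame-atomic⁻¹ : ∀ G → IsAtomic (mapGame f G) → IsAtomic G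
  mapGame-atomic⁻¹ (atom _) t = t

  mapGame-mono-≤ : ∀ {G H} → G ≤A H → mapGame f G ≤B mapGame f H
  mapGame-mono-⊲ : ∀ {G H} → G ⊲A H → mapGame f G ⊲B mapGame f H

  -- Written out rather than via All.map/Any.map so that the mutual recursion
  -- visibly terminates.
  all-⊲ˡ : ∀ {H} Gs → All (_⊲A H) Gs → All (_⊲B mapGame f H) (mapGameL f Gs)
  all-⊲ˡ []       []       = []
  all-⊲ˡ (_ ∷ Gs) (p ∷ ps) = mapGame-mono-⊲ p ∷ all-⊲ˡ Gs ps

  all-⊲ʳ : ∀ {G} Hs → All (G ⊲A_) Hs → All (mapGame f G ⊲B_) (mapGameL f Hs)
  all-⊲ʳ []       []       = []
  all-⊲ʳ (_ ∷ Hs) (p ∷ ps) = mapGame-mono-⊲ p ∷ all-⊲ʳ Hs ps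

  any-≤ˡ : ∀ {H} Gs → Any (_≤A H) Gs → Any (_≤B mapGame f H) (mapGameL f Gs)
  any-≤ˡ (_ ∷ _)  (here p)  = here (mapGame-mono-≤ p)
  any-≤ˡ (_ ∷ Gs) (there p) = there (any-≤ˡ Gs p)

  any-≤ʳ : ∀ {G} Hs → Any (G ≤A_) Hs → Any (mapGame f G ≤B_) (mapGameL f Hs)
  any-≤ʳ (_ ∷ _)  (here p)  = here (mapGame-mono-≤ p)
  any-≤ʳ (_ ∷ Hs) (there p) = there (any-≤ʳ Hs p)

  mapGame-mono-≤ {G} {H} (GA.le left-ok right-ok atomic-ok) =
    GB.le (subst (All _) (sym (lefts-mapGame G)) (all-⊲ˡ (lefts G) left-ok))
          (subst (All _) (sym (rights-mapGame H)) (all-⊲ʳ (rights H) right-ok))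
          λ { (inj₁ atG) → mapGame-mono-⊲ (atomic-ok (inj₁ (mapGame-atomic⁻¹ G atG)))
            ; (inj₂ atH) → mapGame-mono-⊲ (atomic-ok (inj₂ (mapGame-atomic⁻¹ H atH))) }

  mapGame-mono-⊲ {G} (GA.viaRight p) =
    GB.viaRight (subst (Any _) (sym (rights-mapGame G)) (any-≤ˡ (rights G) p))
  mapGame-mono-⊲ {H = H} (GA.viaLeft p) =
    GB.viaLeft (subst (Any _) (sym (lefts-mapGame H)) (any-≤ʳ (lefts H) p))
  mapGame-mono-⊲ (GA.viaAtom {x} {y} x≤y) = GB.viaAtom (f-mono x y x≤y)

  mapGame-cong-≡ : ∀ {G H} → G ≡A H → mapGame f G ≡B mapGame f H
  mapGame-cong-≡ (G≤H , H≤G) = mapGame-mono-≤ G≤H , mapGame-mono-≤ H≤G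

  mapMSCGame : MSCG.MSCGame A → MSCG.MSCGame B
  mapMSCGame S = record
    { size     = size
    ; φ        = λ u → f (φ u)
    ; monotone = λ u v u≤v → f-mono _ _ (monotone u v u≤v)
    }
    where open MSCG.MSCGame S

  module _ (S : MSCG.MSCGame A) where
    open MSCG.MSCGame S using (size)

    mapGame-go : ∀ k p → mapGame f (MSCG.go A S k p) ≡ MSCG.go B (mapMSCGame S) k p
    mapGame-goL : ∀ k p s is →
      mapGameL f (MSCG.goL A S k p s is) ≡ MSCG.goL B (mapMSCGame S) k p s is
    mapGame-go zero p = refl
    mapGame-go (suc k) p with MSCG.starCells A p
    ... | []     = refl
    ... | i ∷ is = cong₂ comp (cong₂ _∷_ (mapGame-go k _) (mapGame-goL k p ⊤c is))
                              (cong₂ _∷_ (mapGame-go k _) (mapGame-goL k p ⊥c is))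
    mapGame-goL k p s []       = refl
    mapGame-goL k p s (i ∷ is) = cong₂ _∷_ (mapGame-go k _) (mapGame-goL k p s is)

    mapGame-⟦⟧ : mapGame f (MSCG.⟦ A ⟧ S) ≡ MSCG.⟦ B ⟧ (mapMSCGame S)
    mapGame-⟦⟧ = mapGame-go size (λ _ → ⋆c)

lemma3p15 : ∀ {a ℓa₁ ℓa₂ b ℓb₁ ℓb₂} (A : Poset a ℓa₁ ℓa₂) (B : Poset b ℓb₁ ℓb₂)
    → HasTopBottom A → HasTopBottom B
    → (G : Game (Poset.Carrier A))
    → (f : Poset.Carrier A → Poset.Carrier B)
    → (∀ x y → Poset._≤_ A x y → Poset._≤_ B (f x) (f y))
    → MSCG.Realizable A G
    → MSCG.Realizable B (mapGame f G)
lemma3p15 A B _ _ G f f-mono (S , G≡⟦S⟧) =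
  mapMSCGame S , subst (GameOrder._≡G_ B (mapGame f G)) (mapGame-⟦⟧ S) (mapGame-cong-≡ G≡⟦S⟧)
  where open MapMonotone A B f f-mono
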